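{- For $d\ge 0$, the numbers $0!,1!,\dots,(d+1)!$ are the eigenvalues of the matrix $\mathbf{F}_d=(f_{i,j})_{ -1\le i,j\le d}$, and the column vector ${}^t(F_{ -1,d},F_{0,d},\dots,F_{d,d})$ is an eigenvector of $\mathbf{F}_d$ for the eigenvalue $(d+1)!$.
   Context: For integers $i,d\ge0$, $f_{i,d}$ is the number of strictly increasing chains $S_0\subsetneq S_1\subsetneq\cdots\subsetneq S_i$ of nonempty subsets of a fixed $(d+1)$-element set with $S_i$ the whole set (so $f_{i,d}=0$ for $i>d$, $f_{d,d}=(d+1)!$); also $f_{ -1,-1}=1$, $f_{ -1,d}=0$ for $d\ge0$, and $f_{i,-1}=0$ for $i\ge0$. For $d\ge0$ the rational numbers $F_{i,d}$, $-1\le i\le d$, are defined by $F_{d,d}=1$, $F_{ -1,d}=0$, and for $0\le i<d$ $$F_{i,d}=\sum_{\substack{i=i_0<i_1<\cdots<i_\ell<d\\ \ell\ge0}}\ \prod_{m=0}^{\ell}\frac{f_{i_m,i_{m+1}}}{(d+1)!-(i_m+1)!},\qquad\text{where } i_{\ell+1}:=d.$$ -}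

module Defs where

open import Data.Nat as ℕ using (ℕ; zero; suc)
open import Data.Nat using (_!)
open import Data.Integer using (+_)
open import Data.Bool using (Bool; true; false)
open import Data.Bool.Properties using () renaming (_≟_ to _≟B_)
open import Data.Fin using (Fin; zero; suc; toℕ; punchIn)
open import Data.Fin.Subset using (Subset; _⊂_; ⊤; Nonempty)
open import Data.Fin.Subset.Properties using (_⊂?_; nonempty?)
open import Data.Vec using (Vec; []; _∷_; last)
open import Data.Vec.Properties using (≡-dec)
open import Data.List using (List; []; _∷_; length; filter; concatMap; map; _++_)
open import Data.Product using (_×_; _,_)
open import Data.Unit using () renaming (⊤ to Unit; tt to unit)
open import Relation.Nullary using (Dec; yes; no; _×-dec_)
open import Relation.Binary.PropositionalEquality using (_≡_)
open import Data.Rational using (ℚ; 0ℚ; 1ℚ; _+_; _*_; _-_; -_; _/_)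

allSubsets : ∀ n → List (Subset n)
allSubsets zero    = [] ∷ []
allSubsets (suc n) = concatMap (λ s → (false ∷ s) ∷ (true ∷ s) ∷ []) (allSubsets n)

allVecs : ∀ {A : Set} k → List A → List (Vec A k)
allVecs zero    xs = [] ∷ []
allVecs (suc k) xs = concatMap (λ x → map (x ∷_) (allVecs k xs)) xs

StrictlyIncreasing : ∀ {n k} → Vec (Subset n) k → Set
StrictlyIncreasing []           = Unit
StrictlyIncreasing (x ∷ [])     = Unit
StrictlyIncreasing (x ∷ y ∷ v)  = x ⊂ y × StrictlyIncreasing (y ∷ v)

strictlyIncreasing? : ∀ {n k} (v : Vec (Subset n) k) → Dec (StrictlyIncreasing v)
strictlyIncreasing? []          = yes unit
strictlyIncreasing? (x ∷ [])    = yes unit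
strictlyIncreasing? (x ∷ y ∷ v) = (x ⊂? y) ×-dec strictlyIncreasing? (y ∷ v)

head′ : ∀ {A : Set} {k} → Vec A (suc k) → A
head′ (x ∷ _) = x

-- a chain S₀ ⊊ ⋯ ⊊ S_i (i+1 entries) of nonempty subsets of Fin n with S_i = Fin n
-- (nonemptiness of S₀ implies nonemptiness of all Sₘ)
IsChain : ∀ {n i} → Vec (Subset n) (suc i) → Set
IsChain v = StrictlyIncreasing v × Nonempty (head′ v) × last v ≡ ⊤

isChain? : ∀ {n i} (v : Vec (Subset n) (suc i)) → Dec (IsChain v)
isChain? v = strictlyIncreasing? v ×-dec (nonempty? (head′ v) ×-dec ≡-dec _≟B_ (last v) ⊤)

-- f i d  =  f_{i,d}  for i, d ≥ 0 : number of such chains in a (d+1)-element set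
f : ℕ → ℕ → ℕ
f i d = length (filter isChain? (allVecs (suc i) (allSubsets (suc d))))

-- The matrix 𝐅_d = (f_{i,j})_{-1 ≤ i,j ≤ d}, indexed by Fin (d+2),
-- where index k : Fin (d+2) stands for k - 1 ∈ {-1,…,d}.
-- Uses f_{-1,-1} = 1, f_{-1,j} = 0 (j ≥ 0), f_{i,-1} = 0 (i ≥ 0).
fMat : ∀ d → Fin (suc (suc d)) → Fin (suc (suc d)) → ℕ
fMat d zero    zero    = 1
fMat d zero    (suc j) = 0
fMat d (suc i) zero    = 0
fMat d (suc i) (suc j) = f (toℕ i) (toℕ j)

ℕ→ℚ : ℕ → ℚ
ℕ→ℚ n = (+ n) / 1

-- a / b in ℚ, with the (never used) convention a / 0 = 0
ratio : ℕ → ℕ → ℚ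
ratio a zero    = 0ℚ
ratio a (suc b) = (+ a) / suc b

sumℚ : List ℚ → ℚ
sumℚ []       = 0ℚ
sumℚ (x ∷ xs) = x + sumℚ xs

prodℚ : List ℚ → ℚ
prodℚ []       = 1ℚ
prodℚ (x ∷ xs) = x * prodℚ xs

Σℚ : ∀ {n} → (Fin n → ℚ) → ℚ
Σℚ {zero}  g = 0ℚ
Σℚ {suc n} g = g zero + Σℚ (λ k → g (suc k))

Πℚ : ∀ {n} → (Fin n → ℚ) → ℚ
Πℚ {zero}  g = 1ℚ
Πℚ {suc n} g = g zero * Πℚ (λ k → g (suc k))

signℚ : ℕ → ℚ
signℚ zero          = 1ℚ
signℚ (suc zero)    = - 1ℚ
signℚ (suc (suc k)) = signℚ k

det : ∀ {n} → (Fin n → Fin n → ℚ) → ℚ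
det {zero}  M = 1ℚ
det {suc n} M = Σℚ (λ j → signℚ (toℕ j) * M zero j * det (λ a b → M (suc a) (punchIn j b)))

δ : ∀ {n} → Fin n → Fin n → ℚ
δ zero    zero    = 1ℚ
δ zero    (suc _) = 0ℚ
δ (suc _) zero    = 0ℚ
δ (suc i) (suc j) = δ i j

charPoly : ∀ {n} → (Fin n → Fin n → ℚ) → ℚ → ℚ
charPoly M x = det (λ i j → x * δ i j - M i j)

sublists : ∀ {A : Set} → List A → List (List A)
sublists []       = [] ∷ []
sublists (x ∷ xs) = sublists xs ++ map (x ∷_) (sublists xs)

range : ℕ → ℕ → List ℕ
range a zero    = []
range a (suc k) = a ∷ range (suc a) k

between : ℕ → ℕ → List ℕ
between i d = range (suc i) (d ℕ.∸ suc i)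

chainWeight : ℕ → ℕ → List ℕ → ℚ
chainWeight d i₀ []        = ratio (f i₀ d) ((suc d) ! ℕ.∸ (suc i₀) !)
chainWeight d i₀ (j ∷ js)  = ratio (f i₀ j) ((suc d) ! ℕ.∸ (suc i₀) !) * chainWeight d j js

Fsum : ℕ → ℕ → ℚ
Fsum i d = sumℚ (map (chainWeight d i) (sublists (between i d)))

-- the vector (F_{-1,d}, F_{0,d}, …, F_{d,d}) indexed by Fin (d+2) (k ↦ F_{k-1,d})
Fvec : ∀ d → Fin (suc (suc d)) → ℚ
Fvec d zero    = 0ℚ
Fvec d (suc i) with toℕ i ℕ.<? d
... | yes _ = Fsum (toℕ i) d
... | no  _ = 1ℚ

module Submission where

-- A strict chain S ⊊ T₁ ⊊ ⋯ ⊊ T_k = ⊤ in the subsets of an N-set exists only if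
-- ∣S∣ + k ≤ N, and when ∣S∣ + k = N every step adds exactly one element, so there are
-- k! of them. Hence f_{i,d} = 0 for i > d and f_{d,d} = (d+1)!: the matrix 𝐅_d is upper
-- triangular with diagonal 0!, 1!, …, (d+1)!, which gives its characteristic polynomial.
-- Sorting the chains i = i₀ < i₁ < ⋯ in the definition of F_{i,d} by i₁ gives
-- ((d+1)! − (i+1)!) F_{i,d} = Σ_{i<j≤d} f_{i,j} F_{j,d}; adding the diagonal term
-- (i+1)! F_{i,d} turns this into row i of 𝐅_d F = (d+1)! F.

open import Defs

module ChainCounting where

  open import Data.Nat using (ℕ; zero; suc; _+_; _*_; _∸_; _<_; s≤s; _!)
  open import Function using (_∘_)
  open import Data.Nat.Properties
  open import Data.Nat.Solver using (module +-*-Solver)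
  open import Data.Bool using (Bool; true; false; _∧_)
  open import Data.Bool.Properties using (∧-assoc; ∧-comm) renaming (_≟_ to _≟B_)
  open import Data.List using (List; []; _∷_; _++_; map; concatMap; filter; length)
  open import Data.Vec using (Vec; []; _∷_; last)
  open import Data.Vec.Properties using (≡-dec)
  open import Data.Fin.Subset using (Subset; _⊂_; ⊤; Nonempty; ∣_∣; inside; outside) renaming (⊥ to ∅)
  open import Data.Fin.Subset.Properties using (_⊂?_; _⊆?_; nonempty?; p⊂q⇒∣p∣<∣q∣; p⊆q⇒∣p∣≤∣q∣; ∣p∣≤n; ∣p∣≡n⇒p≡⊤; ∣⊥∣≡0; ∉⊥)
  open import Data.Product using (_,_)
  open import Relation.Nullary using (Dec; yes; no; does; ¬_)
  open import Relation.Binary.PropositionalEquality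
  open import Data.Empty using (⊥-elim)

  𝟙 : Bool → ℕ
  𝟙 true  = 1
  𝟙 false = 0

  𝟙-∧ : ∀ a b → 𝟙 (a ∧ b) ≡ 𝟙 a * 𝟙 b
  𝟙-∧ true  b = sym (+-identityʳ (𝟙 b))
  𝟙-∧ false b = refl

  𝟙-yes : ∀ {P : Set} (P? : Dec P) → P → 𝟙 (does P?) ≡ 1
  𝟙-yes (yes _) _ = refl
  𝟙-yes (no ¬p) p = ⊥-elim (¬p p)

  𝟙-no : ∀ {P : Set} (P? : Dec P) → ¬ P → 𝟙 (does P?) ≡ 0
  𝟙-no (yes p) ¬p = ⊥-elim (¬p p)
  𝟙-no (no _)  _  = refl

  does-⇔ : ∀ {P Q : Set} (P? : Dec P) (Q? : Dec Q) → (P → Q) → (Q → P) → does P? ≡ does Q?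
  does-⇔ (yes p) (yes q) _ _ = refl
  does-⇔ (yes p) (no ¬q) f _ = ⊥-elim (¬q (f p))
  does-⇔ (no ¬p) (yes q) _ g = ⊥-elim (¬p (g q))
  does-⇔ (no ¬p) (no ¬q) _ _ = refl

  sumOver : ∀ {A : Set} → List A → (A → ℕ) → ℕ
  sumOver []       h = 0
  sumOver (x ∷ xs) h = h x + sumOver xs h

  sumOver-++ : ∀ {A : Set} (xs ys : List A) h → sumOver (xs ++ ys) h ≡ sumOver xs h + sumOver ys h
  sumOver-++ []       ys h = refl
  sumOver-++ (x ∷ xs) ys h = trans (cong (h x +_) (sumOver-++ xs ys h)) (sym (+-assoc (h x) _ _))

  sumOver-map : ∀ {A C : Set} (g : A → C) xs h → sumOver (map g xs) h ≡ sumOver xs (λ x → h (g x))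
  sumOver-map g []       h = refl
  sumOver-map g (x ∷ xs) h = cong (h (g x) +_) (sumOver-map g xs h)

  sumOver-concatMap : ∀ {A C : Set} (g : A → List C) xs h →
                      sumOver (concatMap g xs) h ≡ sumOver xs (λ x → sumOver (g x) h)
  sumOver-concatMap g []       h = refl
  sumOver-concatMap g (x ∷ xs) h =
    trans (sumOver-++ (g x) (concatMap g xs) h) (cong (sumOver (g x) h +_) (sumOver-concatMap g xs h))

  sumOver-cong : ∀ {A : Set} xs {h k : A → ℕ} → (∀ x → h x ≡ k x) → sumOver xs h ≡ sumOver xs k
  sumOver-cong []       e = refl
  sumOver-cong (x ∷ xs) e = cong₂ _+_ (e x) (sumOver-cong xs e)

  sumOver-+ : ∀ {A : Set} xs (h k : A → ℕ) → sumOver xs (λ x → h x + k x) ≡ sumOver xs h + sumOver xs k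
  sumOver-+ []       h k = refl
  sumOver-+ (x ∷ xs) h k = trans (cong (h x + k x +_) (sumOver-+ xs h k))
    (solve 4 (λ a b u v → (a :+ b) :+ (u :+ v) := (a :+ u) :+ (b :+ v)) refl (h x) (k x) (sumOver xs h) (sumOver xs k))
    where open +-*-Solver

  sumOver-*ˡ : ∀ {A : Set} xs c (h : A → ℕ) → sumOver xs (λ x → c * h x) ≡ c * sumOver xs h
  sumOver-*ˡ []       c h = sym (*-zeroʳ c)
  sumOver-*ˡ (x ∷ xs) c h = trans (cong (c * h x +_) (sumOver-*ˡ xs c h)) (sym (*-distribˡ-+ c (h x) _))

  sumOver-*ʳ : ∀ {A : Set} xs c (h : A → ℕ) → sumOver xs (λ x → h x * c) ≡ sumOver xs h * c
  sumOver-*ʳ []       c h = refl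
  sumOver-*ʳ (x ∷ xs) c h = trans (cong (h x * c +_) (sumOver-*ʳ xs c h)) (sym (*-distribʳ-+ c (h x) _))

  sumOver-zero : ∀ {A : Set} xs (h : A → ℕ) → (∀ x → h x ≡ 0) → sumOver xs h ≡ 0
  sumOver-zero []       h e = refl
  sumOver-zero (x ∷ xs) h e = cong₂ _+_ (e x) (sumOver-zero xs h e)

  length-filter≡sumOver : ∀ {A : Set} {P : A → Set} (P? : ∀ x → Dec (P x)) xs →
                          length (filter P? xs) ≡ sumOver xs (λ x → 𝟙 (does (P? x)))
  length-filter≡sumOver P? []       = refl
  length-filter≡sumOver P? (x ∷ xs) with does (P? x)
  ... | false = length-filter≡sumOver P? xs
  ... | true  = cong suc (length-filter≡sumOver P? xs)

  sumOver-allSubsets-suc : ∀ n (h : Subset (suc n) → ℕ) →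
    sumOver (allSubsets (suc n)) h ≡ sumOver (allSubsets n) (λ s → h (outside ∷ s) + h (inside ∷ s))
  sumOver-allSubsets-suc n h = trans (sumOver-concatMap _ (allSubsets n) h)
    (sumOver-cong (allSubsets n) (λ s → cong (h (outside ∷ s) +_) (+-identityʳ (h (inside ∷ s)))))

  count-sameSizeSupersets : ∀ n (s : Subset n) →
    sumOver (allSubsets n) (λ t → 𝟙 (does (s ⊆? t)) * 𝟙 (does (∣ t ∣ ≟ ∣ s ∣))) ≡ 1
  count-sameSizeSupersets zero    []           = refl
  count-sameSizeSupersets (suc n) (inside ∷ s) =
    trans (sumOver-allSubsets-suc n _) (count-sameSizeSupersets n s)
  count-sameSizeSupersets (suc n) (outside ∷ s) = begin
    sumOver (allSubsets (suc n)) _                                          ≡⟨ sumOver-allSubsets-suc n _ ⟩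
    sumOver (allSubsets n) (λ t → same t + 𝟙 (does (s ⊆? t)) * 𝟙 (does (suc ∣ t ∣ ≟ ∣ s ∣)))
                                                                            ≡⟨ sumOver-cong (allSubsets n) (λ t → cong (same t +_) (too-big t)) ⟩
    sumOver (allSubsets n) (λ t → same t + 0)                               ≡⟨ sumOver-cong (allSubsets n) (λ t → +-identityʳ (same t)) ⟩
    sumOver (allSubsets n) same                                             ≡⟨ count-sameSizeSupersets n s ⟩
    1                                                                       ∎
    where
    open ≡-Reasoning
    same : Subset n → ℕ
    same t = 𝟙 (does (s ⊆? t)) * 𝟙 (does (∣ t ∣ ≟ ∣ s ∣))
    too-big : ∀ t → 𝟙 (does (s ⊆? t)) * 𝟙 (does (suc ∣ t ∣ ≟ ∣ s ∣)) ≡ 0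
    too-big t with s ⊆? t
    ... | no  _   = refl
    ... | yes s⊆t = trans (+-identityʳ _)
                      (𝟙-no (suc ∣ t ∣ ≟ ∣ s ∣) (λ e → <⇒≱ (≤-reflexive e) (p⊆q⇒∣p∣≤∣q∣ s⊆t)))

  count-coveringSupersets : ∀ n (s : Subset n) →
    sumOver (allSubsets n) (λ t → 𝟙 (does (s ⊂? t)) * 𝟙 (does (∣ t ∣ ≟ suc ∣ s ∣))) ≡ n ∸ ∣ s ∣
  count-coveringSupersets zero    []           = refl
  count-coveringSupersets (suc n) (inside ∷ s) =
    trans (sumOver-allSubsets-suc n _) (count-coveringSupersets n s)
  count-coveringSupersets (suc n) (outside ∷ s) = begin
    sumOver (allSubsets (suc n)) _                                          ≡⟨ sumOver-allSubsets-suc n _ ⟩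
    sumOver (allSubsets n) (λ t → covering t + same t)                      ≡⟨ sumOver-+ (allSubsets n) covering same ⟩
    sumOver (allSubsets n) covering + sumOver (allSubsets n) same           ≡⟨ cong₂ _+_ (count-coveringSupersets n s) (count-sameSizeSupersets n s) ⟩
    n ∸ ∣ s ∣ + 1                                                           ≡⟨ +-comm (n ∸ ∣ s ∣) 1 ⟩
    suc (n ∸ ∣ s ∣)                                                         ≡⟨ +-∸-assoc 1 (∣p∣≤n s) ⟨
    suc n ∸ ∣ s ∣                                                           ∎
    where
    open ≡-Reasoning
    covering same : Subset n → ℕ
    covering t = 𝟙 (does (s ⊂? t)) * 𝟙 (does (∣ t ∣ ≟ suc ∣ s ∣))
    same     t = 𝟙 (does (s ⊆? t)) * 𝟙 (does (∣ t ∣ ≟ ∣ s ∣))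

  module ChainsToTop (N : ℕ) where

    risesToTop : ∀ {k} → Subset N → Vec (Subset N) k → Bool
    risesToTop S w = does (strictlyIncreasing? (S ∷ w)) ∧ does (≡-dec _≟B_ (last (S ∷ w)) ⊤)

    chainsToTop : ℕ → Subset N → ℕ
    chainsToTop k S = sumOver (allVecs k (allSubsets N)) (λ w → 𝟙 (risesToTop S w))

    chainsToTop-suc : ∀ k S →
      chainsToTop (suc k) S ≡ sumOver (allSubsets N) (λ T → 𝟙 (does (S ⊂? T)) * chainsToTop k T)
    chainsToTop-suc k S = trans (sumOver-concatMap _ (allSubsets N) _) (sumOver-cong (allSubsets N) λ T →
      trans (sumOver-map (T ∷_) (allVecs k (allSubsets N)) _)
        (trans (sumOver-cong (allVecs k (allSubsets N)) (λ w → first-step T w))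
               (sumOver-*ˡ (allVecs k (allSubsets N)) (𝟙 (does (S ⊂? T))) _)))
      where
      first-step : ∀ T (w : Vec (Subset N) k) → 𝟙 (risesToTop S (T ∷ w)) ≡ 𝟙 (does (S ⊂? T)) * 𝟙 (risesToTop T w)
      first-step T w = trans (cong 𝟙 (∧-assoc (does (S ⊂? T)) _ _)) (𝟙-∧ (does (S ⊂? T)) _)

    chainsToTop-tooLong : ∀ k S → N < ∣ S ∣ + k → chainsToTop k S ≡ 0
    chainsToTop-tooLong zero    S N<∣S∣+0 = ⊥-elim (<⇒≱ N<∣S∣+0 (≤-trans (≤-reflexive (+-identityʳ ∣ S ∣)) (∣p∣≤n S)))
    chainsToTop-tooLong (suc k) S N<∣S∣+k = trans (chainsToTop-suc k S) (sumOver-zero (allSubsets N) _ no-chain)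
      where
      no-chain : ∀ T → 𝟙 (does (S ⊂? T)) * chainsToTop k T ≡ 0
      no-chain T with S ⊂? T
      ... | no  _   = refl
      ... | yes S⊂T = trans (*-identityˡ _) (chainsToTop-tooLong k T (<-≤-trans N<∣S∣+k
                        (≤-trans (≤-reflexive (+-suc ∣ S ∣ k)) (+-monoˡ-≤ k (p⊂q⇒∣p∣<∣q∣ S⊂T)))))

    chainsToTop-exact : ∀ k S → ∣ S ∣ + k ≡ N → chainsToTop k S ≡ k !
    chainsToTop-exact zero S ∣S∣+0≡N =
      trans (+-identityʳ _) (𝟙-yes (≡-dec _≟B_ S ⊤) (∣p∣≡n⇒p≡⊤ (trans (sym (+-identityʳ _)) ∣S∣+0≡N)))
    chainsToTop-exact (suc k) S ∣S∣+k≡N = begin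
      chainsToTop (suc k) S                                                  ≡⟨ chainsToTop-suc k S ⟩
      sumOver (allSubsets N) (λ T → 𝟙 (does (S ⊂? T)) * chainsToTop k T)      ≡⟨ sumOver-cong (allSubsets N) only-covers ⟩
      sumOver (allSubsets N) (λ T → covers T * k !)                          ≡⟨ sumOver-*ʳ (allSubsets N) (k !) covers ⟩
      sumOver (allSubsets N) covers * k !                                    ≡⟨ cong (_* k !) (count-coveringSupersets N S) ⟩
      (N ∸ ∣ S ∣) * k !                                                      ≡⟨ cong (λ n → (n ∸ ∣ S ∣) * k !) ∣S∣+k≡N ⟨
      (∣ S ∣ + suc k ∸ ∣ S ∣) * k !                                          ≡⟨ cong (_* k !) (m+n∸m≡n ∣ S ∣ (suc k)) ⟩
      suc k * k !                                                            ∎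
      where
      open ≡-Reasoning
      covers : Subset N → ℕ
      covers T = 𝟙 (does (S ⊂? T)) * 𝟙 (does (∣ T ∣ ≟ suc ∣ S ∣))
      ∣S∣+1+k≡N : suc ∣ S ∣ + k ≡ N
      ∣S∣+1+k≡N = trans (sym (+-suc ∣ S ∣ k)) ∣S∣+k≡N
      only-covers : ∀ T → 𝟙 (does (S ⊂? T)) * chainsToTop k T ≡ covers T * k !
      only-covers T with S ⊂? T
      ... | no  _   = refl
      ... | yes S⊂T with ∣ T ∣ ≟ suc ∣ S ∣
      ...   | yes ∣T∣≡1+∣S∣ = trans (*-identityˡ _) (trans
                (chainsToTop-exact k T (trans (cong (_+ k) ∣T∣≡1+∣S∣) ∣S∣+1+k≡N))
                (sym (trans (cong (λ b → 1 * b * k !) (𝟙-yes (∣ T ∣ ≟ suc ∣ S ∣) ∣T∣≡1+∣S∣)) (*-identityˡ (k !)))))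
      ...   | no  ∣T∣≢1+∣S∣ = trans (*-identityˡ _) (trans
                (chainsToTop-tooLong k T (subst (_< ∣ T ∣ + k) ∣S∣+1+k≡N
                  (+-monoˡ-< k (≤∧≢⇒< (p⊂q⇒∣p∣<∣q∣ S⊂T) (∣T∣≢1+∣S∣ ∘ sym)))))
                (sym (cong (λ b → 1 * b * k !) (𝟙-no (∣ T ∣ ≟ suc ∣ S ∣) ∣T∣≢1+∣S∣))))

    -- S₀ is nonempty iff ∅ ⊂ S₀, so a chain is a rise from ∅ with one extra step
    chains≡chainsToTop-∅ : ∀ i → length (filter isChain? (allVecs (suc i) (allSubsets N))) ≡ chainsToTop (suc i) ∅
    chains≡chainsToTop-∅ i = begin
      length (filter isChain? (allVecs (suc i) (allSubsets N)))
        ≡⟨ length-filter≡sumOver isChain? (allVecs (suc i) (allSubsets N)) ⟩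
      sumOver (concatMap (λ S → map (S ∷_) (allVecs i (allSubsets N))) (allSubsets N)) (λ v → 𝟙 (does (isChain? v)))
        ≡⟨ sumOver-concatMap _ (allSubsets N) _ ⟩
      sumOver (allSubsets N) (λ S → sumOver (map (S ∷_) (allVecs i (allSubsets N))) (λ v → 𝟙 (does (isChain? v))))
        ≡⟨ sumOver-cong (allSubsets N) (λ S → trans (sumOver-map (S ∷_) (allVecs i (allSubsets N)) _)
             (trans (sumOver-cong (allVecs i (allSubsets N)) (isChain-split S))
                    (sumOver-*ˡ (allVecs i (allSubsets N)) (𝟙 (does (nonempty? S))) _))) ⟩
      sumOver (allSubsets N) (λ S → 𝟙 (does (nonempty? S)) * chainsToTop i S)
        ≡⟨ sumOver-cong (allSubsets N) (λ S → cong (λ b → 𝟙 b * chainsToTop i S) (does-⇔ (nonempty? S) (∅ ⊂? S) ∅⊂ ⊂-nonempty)) ⟩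
      sumOver (allSubsets N) (λ S → 𝟙 (does (∅ ⊂? S)) * chainsToTop i S)
        ≡⟨ chainsToTop-suc i ∅ ⟨
      chainsToTop (suc i) ∅ ∎
      where
      open ≡-Reasoning
      isChain-split : ∀ S (w : Vec (Subset N) i) → 𝟙 (does (isChain? (S ∷ w))) ≡ 𝟙 (does (nonempty? S)) * 𝟙 (risesToTop S w)
      isChain-split S w = trans (cong 𝟙 (∧-swapˡ (does (strictlyIncreasing? (S ∷ w))) (does (nonempty? S)) _)) (𝟙-∧ (does (nonempty? S)) _)
        where
        ∧-swapˡ : ∀ a b c → a ∧ (b ∧ c) ≡ b ∧ (a ∧ c)
        ∧-swapˡ a b c = trans (sym (∧-assoc a b c)) (trans (cong (_∧ c) (∧-comm a b)) (∧-assoc b a c))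
      ∅⊂ : ∀ {S} → Nonempty S → ∅ ⊂ S
      ∅⊂ (x , x∈S) = (λ y∈∅ → ⊥-elim (∉⊥ y∈∅)) , x , x∈S , ∉⊥
      ⊂-nonempty : ∀ {S} → ∅ ⊂ S → Nonempty S
      ⊂-nonempty (_ , x , x∈S , _) = x , x∈S

  f-belowDiagonal : ∀ {i d} → d < i → f i d ≡ 0
  f-belowDiagonal {i} {d} d<i = trans (chains≡chainsToTop-∅ i) (chainsToTop-tooLong (suc i) ∅
    (subst (λ n → suc d < n + suc i) (sym (∣⊥∣≡0 (suc d))) (s≤s d<i)))
    where open ChainsToTop (suc d)

  f-diagonal : ∀ d → f d d ≡ suc d !
  f-diagonal d = trans (chains≡chainsToTop-∅ d) (chainsToTop-exact (suc d) ∅ (cong (_+ suc d) (∣⊥∣≡0 (suc d))))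
    where open ChainsToTop (suc d)

open ChainCounting using (f-belowDiagonal; f-diagonal)

open import Data.Nat as ℕ using (ℕ; zero; suc; _!; s≤s; z≤n; s≤s⁻¹)
import Data.Nat.Properties as ℕ
open import Data.Integer as ℤ using (+_)
import Data.Integer.Properties as ℤ
open import Data.Fin as Fin using (Fin; zero; suc; toℕ; punchIn; fromℕ)
open import Data.Fin.Properties using (toℕ<n; toℕ-fromℕ)
open import Data.Rational using (ℚ; 0ℚ; 1ℚ; _+_; _*_; _-_; toℚᵘ)
open import Data.Rational.Properties
open import Data.Rational.Unnormalised as ℚᵘ using (mkℚᵘ; *≡*)
import Data.Rational.Unnormalised.Properties as ℚᵘ
open import Relation.Binary.PropositionalEquality
open import Function using (_∘_)
open import Data.List using (List; []; _∷_; _++_; map)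
open import Data.List.Properties using (map-++; map-∘)
open import Data.Empty using (⊥-elim)
open import Relation.Nullary using (yes; no)
open import Data.Sum using ([_,_]′)
open import Data.Product using (_×_; _,_; ∃)

ℕ→ℚ-+ : ∀ m n → ℕ→ℚ (m ℕ.+ n) ≡ ℕ→ℚ m + ℕ→ℚ n
ℕ→ℚ-+ m n = toℚᵘ-injective (begin
  toℚᵘ (ℕ→ℚ (m ℕ.+ n))                    ≈⟨ toℚᵘ-fromℚᵘ (mkℚᵘ (+ (m ℕ.+ n)) 0) ⟩
  mkℚᵘ (+ (m ℕ.+ n)) 0                     ≈⟨ *≡* (cong (ℤ._* + 1) integral) ⟩
  mkℚᵘ (+ m) 0 ℚᵘ.+ mkℚᵘ (+ n) 0            ≈⟨ ℚᵘ.+-cong (toℚᵘ-fromℚᵘ (mkℚᵘ (+ m) 0)) (toℚᵘ-fromℚᵘ (mkℚᵘ (+ n) 0)) ⟨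
  toℚᵘ (ℕ→ℚ m) ℚᵘ.+ toℚᵘ (ℕ→ℚ n)            ≈⟨ toℚᵘ-homo-+ (ℕ→ℚ m) (ℕ→ℚ n) ⟨
  toℚᵘ (ℕ→ℚ m + ℕ→ℚ n)                     ∎)
  where
  open ℚᵘ.≃-Reasoning
  integral : + (m ℕ.+ n) ≡ + m ℤ.* + 1 ℤ.+ + n ℤ.* + 1
  integral = trans (ℤ.pos-+ m n) (sym (cong₂ ℤ._+_ (ℤ.*-identityʳ (+ m)) (ℤ.*-identityʳ (+ n))))

ratio-cancelˡ : ∀ a n → 0 ℕ.< n → ℕ→ℚ n * ratio a n ≡ ℕ→ℚ a
ratio-cancelˡ a (suc b) _ = toℚᵘ-injective (begin
  toℚᵘ (ℕ→ℚ (suc b) * ratio a (suc b))            ≈⟨ toℚᵘ-homo-* (ℕ→ℚ (suc b)) (ratio a (suc b)) ⟩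
  toℚᵘ (ℕ→ℚ (suc b)) ℚᵘ.* toℚᵘ (ratio a (suc b))  ≈⟨ ℚᵘ.*-cong (toℚᵘ-fromℚᵘ (mkℚᵘ (+ suc b) 0)) (toℚᵘ-fromℚᵘ (mkℚᵘ (+ a) b)) ⟩
  mkℚᵘ (+ suc b) 0 ℚᵘ.* mkℚᵘ (+ a) b               ≈⟨ *≡* integral ⟩
  mkℚᵘ (+ a) 0                                      ≈⟨ toℚᵘ-fromℚᵘ (mkℚᵘ (+ a) 0) ⟨
  toℚᵘ (ℕ→ℚ a)                                      ∎)
  where
  open ℚᵘ.≃-Reasoning
  integral : + suc b ℤ.* + a ℤ.* + 1 ≡ + a ℤ.* + suc (b ℕ.+ 0)
  integral = trans (ℤ.*-identityʳ _) (trans (ℤ.*-comm (+ suc b) (+ a)) (cong (λ k → + a ℤ.* + suc k) (sym (ℕ.+-identityʳ b))))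

Σℚ-cong : ∀ {n} {g h : Fin n → ℚ} → (∀ j → g j ≡ h j) → Σℚ g ≡ Σℚ h
Σℚ-cong {zero}  g≗h = refl
Σℚ-cong {suc n} g≗h = cong₂ _+_ (g≗h zero) (Σℚ-cong (g≗h ∘ suc))

Σℚ-zero : ∀ {n} (g : Fin n → ℚ) → (∀ j → g j ≡ 0ℚ) → Σℚ g ≡ 0ℚ
Σℚ-zero {zero}  g g≗0 = refl
Σℚ-zero {suc n} g g≗0 = trans (cong₂ _+_ (g≗0 zero) (Σℚ-zero (g ∘ suc) (g≗0 ∘ suc))) (+-identityˡ 0ℚ)

Πℚ-cong : ∀ {n} {g h : Fin n → ℚ} → (∀ j → g j ≡ h j) → Πℚ g ≡ Πℚ h
Πℚ-cong {zero}  g≗h = refl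
Πℚ-cong {suc n} g≗h = cong₂ _*_ (g≗h zero) (Πℚ-cong (g≗h ∘ suc))

Matrix : ℕ → Set
Matrix n = Fin n → Fin n → ℚ

minor : ∀ {n} → Matrix (suc n) → Fin (suc n) → Matrix n
minor M j a b = M (suc a) (punchIn j b)

cofactorTerm : ∀ {n} → Matrix (suc n) → Fin (suc n) → ℚ
cofactorTerm M j = signℚ (toℕ j) * M zero j * det (minor M j)

cofactorTerm-entry0 : ∀ {n} (M : Matrix (suc n)) j → M zero j ≡ 0ℚ → cofactorTerm M j ≡ 0ℚ
cofactorTerm-entry0 M j M₀ⱼ≡0 = begin
  signℚ (toℕ j) * M zero j * det (minor M j) ≡⟨ cong (λ x → signℚ (toℕ j) * x * det (minor M j)) M₀ⱼ≡0 ⟩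
  signℚ (toℕ j) * 0ℚ * det (minor M j)       ≡⟨ cong (_* det (minor M j)) (*-zeroʳ (signℚ (toℕ j))) ⟩
  0ℚ * det (minor M j)                        ≡⟨ *-zeroˡ (det (minor M j)) ⟩
  0ℚ                                          ∎
  where open ≡-Reasoning

cofactorTerm-minor0 : ∀ {n} (M : Matrix (suc n)) j → det (minor M j) ≡ 0ℚ → cofactorTerm M j ≡ 0ℚ
cofactorTerm-minor0 M j detMⱼ≡0 =
  trans (cong (signℚ (toℕ j) * M zero j *_) detMⱼ≡0) (*-zeroʳ (signℚ (toℕ j) * M zero j))

mutual
  det-zeroColumn : ∀ {n} (M : Matrix (suc n)) → (∀ a → M a zero ≡ 0ℚ) → det M ≡ 0ℚ
  det-zeroColumn M col₀≡0 = Σℚ-zero (cofactorTerm M) term≡0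
    where
    term≡0 : ∀ j → cofactorTerm M j ≡ 0ℚ
    term≡0 zero    = cofactorTerm-entry0 M zero (col₀≡0 zero)
    term≡0 (suc j) = cofactorTerm-minor0 M (suc j) (det-minor-zeroColumn M (col₀≡0 ∘ suc) j)

  -- deleting a column other than the first keeps the first column of the minor
  det-minor-zeroColumn : ∀ {n} (M : Matrix (suc n)) → (∀ a → M (suc a) zero ≡ 0ℚ) →
                         (j : Fin n) → det (minor M (suc j)) ≡ 0ℚ
  det-minor-zeroColumn {suc n} M col₀≡0 j = det-zeroColumn (minor M (suc j)) col₀≡0

UpperTriangular : ∀ {n} → Matrix n → Set
UpperTriangular M = ∀ i j → j Fin.< i → M i j ≡ 0ℚ

det-upperTriangular : ∀ {n} (M : Matrix n) → UpperTriangular M → det M ≡ Πℚ (λ k → M k k)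
det-upperTriangular {zero}  M _ = refl
det-upperTriangular {suc n} M M-ut = begin
  cofactorTerm M zero + Σℚ (cofactorTerm M ∘ suc)                   ≡⟨ cong₂ _+_ first-term (Σℚ-zero _ other-terms) ⟩
  M zero zero * Πℚ (λ k → M (suc k) (suc k)) + 0ℚ                  ≡⟨ +-identityʳ _ ⟩
  M zero zero * Πℚ (λ k → M (suc k) (suc k))                       ∎
  where
  open ≡-Reasoning
  first-term : cofactorTerm M zero ≡ M zero zero * Πℚ (λ k → M (suc k) (suc k))
  first-term = cong₂ _*_ (*-identityˡ (M zero zero))
                 (det-upperTriangular (minor M zero) (λ i j j<i → M-ut (suc i) (suc j) (s≤s j<i)))
  other-terms : ∀ j → cofactorTerm M (suc j) ≡ 0ℚ
  other-terms j = cofactorTerm-minor0 M (suc j) (det-minor-zeroColumn M (λ a → M-ut (suc a) zero (s≤s z≤n)) j)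

δ-diagonal : ∀ {n} (k : Fin n) → δ k k ≡ 1ℚ
δ-diagonal zero    = refl
δ-diagonal (suc k) = δ-diagonal k

δ-belowDiagonal : ∀ {n} (i j : Fin n) → j Fin.< i → δ i j ≡ 0ℚ
δ-belowDiagonal (suc i) zero    _   = refl
δ-belowDiagonal (suc i) (suc j) j<i = δ-belowDiagonal i j (s≤s⁻¹ j<i)

charPoly-upperTriangular : ∀ {n} (M : Matrix n) → UpperTriangular M →
                           ∀ x → charPoly M x ≡ Πℚ (λ k → x - M k k)
charPoly-upperTriangular M M-ut x = trans (det-upperTriangular _ xI-M-ut) (Πℚ-cong diagonal)
  where
  xI-M-ut : UpperTriangular (λ i j → x * δ i j - M i j)
  xI-M-ut i j j<i = trans (cong₂ (λ d m → x * d - m) (δ-belowDiagonal i j j<i) (M-ut i j j<i)) (cong (_- 0ℚ) (*-zeroʳ x))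
  diagonal : ∀ k → x * δ k k - M k k ≡ x - M k k
  diagonal k = trans (cong (λ d → x * d - M k k) (δ-diagonal k)) (cong (_- M k k) (*-identityʳ x))

fMat-belowDiagonal : ∀ d (i j : Fin (suc (suc d))) → j Fin.< i → fMat d i j ≡ 0
fMat-belowDiagonal d (suc i) zero    _   = refl
fMat-belowDiagonal d (suc i) (suc j) j<i = f-belowDiagonal (ℕ.s<s⁻¹ j<i)

fMat-diagonal : ∀ d (k : Fin (suc (suc d))) → fMat d k k ≡ toℕ k !
fMat-diagonal d zero    = refl
fMat-diagonal d (suc k) = f-diagonal (toℕ k)

charPoly-fMat : ∀ d x → charPoly (λ i j → ℕ→ℚ (fMat d i j)) x ≡ Πℚ (λ (k : Fin (suc (suc d))) → x - ℕ→ℚ (toℕ k !))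
charPoly-fMat d x = trans (charPoly-upperTriangular _ fMat-ut x) (Πℚ-cong (λ k → cong (λ n → x - ℕ→ℚ n) (fMat-diagonal d k)))
  where
  fMat-ut : UpperTriangular (λ i j → ℕ→ℚ (fMat d i j))
  fMat-ut i j j<i = cong ℕ→ℚ (fMat-belowDiagonal d i j j<i)

!-mono-≤ : ∀ {m n} → m ℕ.≤ n → m ! ℕ.≤ n !
!-mono-≤ {n = n} z≤n     = ℕ.1≤n! n
!-mono-≤ (s≤s m≤n) = ℕ.*-mono-≤ (s≤s m≤n) (!-mono-≤ m≤n)

suc-!-mono-< : ∀ {m n} → m ℕ.< n → suc m ! ℕ.< suc n !
suc-!-mono-< {m} {suc n} (s≤s m≤n) =
  ℕ.≤-<-trans (!-mono-≤ (s≤s m≤n)) (ℕ.m<m+n (suc n !) (ℕ.*-mono-≤ (s≤s (z≤n {n})) (ℕ.1≤n! (suc n))))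

sumRange : ℕ → ℕ → (ℕ → ℚ) → ℚ
sumRange a zero    h = 0ℚ
sumRange a (suc k) h = h a + sumRange (suc a) k h

sumRange-shift : ∀ a k (h : ℕ → ℚ) → sumRange (suc a) k h ≡ sumRange a k (h ∘ suc)
sumRange-shift a zero    h = refl
sumRange-shift a (suc k) h = cong (λ s → h (suc a) + s) (sumRange-shift (suc a) k h)

Σℚ≡sumRange : ∀ n (h : ℕ → ℚ) → Σℚ {n} (h ∘ toℕ) ≡ sumRange 0 n h
Σℚ≡sumRange zero    h = refl
Σℚ≡sumRange (suc n) h = cong (λ s → h 0 + s) (trans (Σℚ≡sumRange n (h ∘ suc)) (sym (sumRange-shift 0 n h)))

sumRange-cong : ∀ a k {g h : ℕ → ℚ} → (∀ m → m ℕ.< a ℕ.+ k → g m ≡ h m) → sumRange a k g ≡ sumRange a k h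
sumRange-cong a zero    g≗h = refl
sumRange-cong a (suc k) g≗h = cong₂ _+_ (g≗h a (ℕ.m<m+n a (s≤s z≤n)))
  (sumRange-cong (suc a) k (λ m m<1+a+k → g≗h m (subst (m ℕ.<_) (sym (ℕ.+-suc a k)) m<1+a+k)))

sumRange-zero : ∀ a k (h : ℕ → ℚ) → (∀ m → m ℕ.< a ℕ.+ k → h m ≡ 0ℚ) → sumRange a k h ≡ 0ℚ
sumRange-zero a zero    h h≗0 = refl
sumRange-zero a (suc k) h h≗0 = trans (sumRange-cong a (suc k) h≗0) (zero-terms a (suc k))
  where
  zero-terms : ∀ a k → sumRange a k (λ _ → 0ℚ) ≡ 0ℚ
  zero-terms a zero    = refl
  zero-terms a (suc k) = trans (+-identityˡ _) (zero-terms (suc a) k)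

sumRange-split : ∀ a m n (h : ℕ → ℚ) → sumRange a (m ℕ.+ n) h ≡ sumRange a m h + sumRange (a ℕ.+ m) n h
sumRange-split a zero    n h = sym (trans (+-identityˡ _) (cong (λ b → sumRange b n h) (ℕ.+-identityʳ a)))
sumRange-split a (suc m) n h = begin
  h a + sumRange (suc a) (m ℕ.+ n) h                                  ≡⟨ cong (λ s → h a + s) (sumRange-split (suc a) m n h) ⟩
  h a + (sumRange (suc a) m h + sumRange (suc a ℕ.+ m) n h)            ≡⟨ +-assoc (h a) _ _ ⟨
  h a + sumRange (suc a) m h + sumRange (suc a ℕ.+ m) n h              ≡⟨ cong (λ b → h a + sumRange (suc a) m h + sumRange b n h) (ℕ.+-suc a m) ⟨
  h a + sumRange (suc a) m h + sumRange (a ℕ.+ suc m) n h              ∎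
  where open ≡-Reasoning

sumRange-*ˡ : ∀ a k c (h : ℕ → ℚ) → c * sumRange a k h ≡ sumRange a k (λ m → c * h m)
sumRange-*ˡ a zero    c h = *-zeroʳ c
sumRange-*ˡ a (suc k) c h = trans (*-distribˡ-+ c (h a) _) (cong (λ s → c * h a + s) (sumRange-*ˡ (suc a) k c h))

-- F i d is F_{i,d}; the junk value 1 for i > d is never used
F : ℕ → ℕ → ℚ
F i d with i ℕ.<? d
... | yes _ = Fsum i d
... | no  _ = 1ℚ

F-< : ∀ {i d} → i ℕ.< d → F i d ≡ Fsum i d
F-< {i} {d} i<d with i ℕ.<? d
... | yes _   = refl
... | no  i≮d = ⊥-elim (i≮d i<d)

F-diagonal : ∀ d → F d d ≡ 1ℚ
F-diagonal d with d ℕ.<? d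
... | yes d<d = ⊥-elim (ℕ.<-irrefl refl d<d)
... | no  _   = refl

Fvec-suc : ∀ d (k : Fin (suc d)) → Fvec d (suc k) ≡ F (toℕ k) d
Fvec-suc d k with toℕ k ℕ.<? d
... | yes _ = refl
... | no  _ = refl

denominator : ℕ → ℕ → ℕ
denominator d i = suc d ! ℕ.∸ suc i !

weight : ℕ → ℕ → ℕ → ℚ
weight d i j = ratio (f i j) (denominator d i)

chainSum : ℕ → ℕ → List ℕ → ℚ
chainSum d i js = sumℚ (map (chainWeight d i) (sublists js))

sumℚ-++ : ∀ xs ys → sumℚ (xs ++ ys) ≡ sumℚ xs + sumℚ ys
sumℚ-++ []       ys = sym (+-identityˡ _)
sumℚ-++ (x ∷ xs) ys = trans (cong (λ s → x + s) (sumℚ-++ xs ys)) (sym (+-assoc x (sumℚ xs) _))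

sumℚ-map-*ˡ : ∀ {A : Set} c (g : A → ℚ) xs → sumℚ (map (λ x → c * g x) xs) ≡ c * sumℚ (map g xs)
sumℚ-map-*ˡ c g []       = sym (*-zeroʳ c)
sumℚ-map-*ˡ c g (x ∷ xs) = trans (cong (λ s → c * g x + s) (sumℚ-map-*ˡ c g xs)) (sym (*-distribˡ-+ c (g x) _))

chainSum-∷ : ∀ d i j js → chainSum d i (j ∷ js) ≡ chainSum d i js + weight d i j * chainSum d j js
chainSum-∷ d i j js = begin
  sumℚ (map (chainWeight d i) (sublists js ++ map (j ∷_) (sublists js)))
    ≡⟨ cong sumℚ (map-++ (chainWeight d i) (sublists js) _) ⟩
  sumℚ (map (chainWeight d i) (sublists js) ++ map (chainWeight d i) (map (j ∷_) (sublists js)))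
    ≡⟨ sumℚ-++ (map (chainWeight d i) (sublists js)) _ ⟩
  chainSum d i js + sumℚ (map (chainWeight d i) (map (j ∷_) (sublists js)))
    ≡⟨ cong (λ xs → chainSum d i js + sumℚ xs) (map-∘ (sublists js)) ⟨
  chainSum d i js + sumℚ (map (λ ks → weight d i j * chainWeight d j ks) (sublists js))
    ≡⟨ cong (λ s → chainSum d i js + s) (sumℚ-map-*ˡ (weight d i j) (chainWeight d j) (sublists js)) ⟩
  chainSum d i js + weight d i j * chainSum d j js ∎
  where open ≡-Reasoning

-- the summand j = d collects the chains that stop at i (weight f_{i,d} · F_{d,d})
chainSum-range : ∀ d i a k → a ℕ.+ k ≡ d →
                 chainSum d i (range a k) ≡ sumRange a (suc k) (λ j → weight d i j * F j d)
chainSum-range d i a zero a+0≡d = begin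
  weight d i d + 0ℚ               ≡⟨ cong (_+ 0ℚ) (*-identityʳ (weight d i d)) ⟨
  weight d i d * 1ℚ + 0ℚ          ≡⟨ cong (λ x → weight d i d * x + 0ℚ) (F-diagonal d) ⟨
  weight d i d * F d d + 0ℚ       ≡⟨ cong (λ j → weight d i j * F j d + 0ℚ) a≡d ⟨
  weight d i a * F a d + 0ℚ       ∎
  where
  open ≡-Reasoning
  a≡d : a ≡ d
  a≡d = trans (sym (ℕ.+-identityʳ a)) a+0≡d

chainSum-range d i a (suc k) a+1+k≡d = begin
  chainSum d i (a ∷ range (suc a) k)
    ≡⟨ chainSum-∷ d i a (range (suc a) k) ⟩
  chainSum d i (range (suc a) k) + weight d i a * chainSum d a (range (suc a) k)
    ≡⟨ cong₂ _+_ (chainSum-range d i (suc a) k 1+a+k≡d) (cong (weight d i a *_) tail≡F) ⟩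
  sumRange (suc a) (suc k) g + weight d i a * F a d
    ≡⟨ +-comm (sumRange (suc a) (suc k) g) (g a) ⟩
  sumRange a (suc (suc k)) g ∎
  where
  open ≡-Reasoning
  g : ℕ → ℚ
  g j = weight d i j * F j d
  1+a+k≡d : suc a ℕ.+ k ≡ d
  1+a+k≡d = trans (sym (ℕ.+-suc a k)) a+1+k≡d
  tail≡F : chainSum d a (range (suc a) k) ≡ F a d
  tail≡F = begin
    chainSum d a (range (suc a) k)      ≡⟨ cong (λ n → chainSum d a (range (suc a) n)) d∸[1+a]≡k ⟨
    Fsum a d                            ≡⟨ F-< (subst (a ℕ.<_) a+1+k≡d (ℕ.m<m+n a (s≤s z≤n))) ⟨
    F a d                               ∎
    where
    d∸[1+a]≡k : d ℕ.∸ suc a ≡ k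
    d∸[1+a]≡k = trans (cong (ℕ._∸ suc a) (sym 1+a+k≡d)) (ℕ.m+n∸m≡n (suc a) k)

F-recursion-diagonal : ∀ i → ℕ→ℚ (denominator i i) * F i i ≡ sumRange (suc i) (i ℕ.∸ i) (λ j → ℕ→ℚ (f i j) * F j i)
F-recursion-diagonal i = begin
  ℕ→ℚ (denominator i i) * F i i               ≡⟨ cong (λ n → ℕ→ℚ n * F i i) (ℕ.n∸n≡0 (suc i !)) ⟩
  0ℚ * F i i                                  ≡⟨ *-zeroˡ (F i i) ⟩
  0ℚ                                          ≡⟨ cong (λ n → sumRange (suc i) n h) (ℕ.n∸n≡0 i) ⟨
  sumRange (suc i) (i ℕ.∸ i) h                ∎
  where
  open ≡-Reasoning
  h : ℕ → ℚ
  h j = ℕ→ℚ (f i j) * F j i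

F-recursion-< : ∀ {i d} → i ℕ.< d →
                ℕ→ℚ (denominator d i) * F i d ≡ sumRange (suc i) (d ℕ.∸ i) (λ j → ℕ→ℚ (f i j) * F j d)
F-recursion-< {i} {d} i<d = begin
  D * F i d                                                   ≡⟨ cong (D *_) (F-< i<d) ⟩
  D * chainSum d i (range (suc i) k)                          ≡⟨ cong (D *_) (chainSum-range d i (suc i) k (ℕ.m+[n∸m]≡n i<d)) ⟩
  D * sumRange (suc i) (suc k) (λ j → weight d i j * F j d)   ≡⟨ sumRange-*ˡ (suc i) (suc k) D _ ⟩
  sumRange (suc i) (suc k) (λ j → D * (weight d i j * F j d)) ≡⟨ sumRange-cong (suc i) (suc k) (λ j _ → clear-denominator j) ⟩
  sumRange (suc i) (suc k) h                                  ≡⟨ cong (λ n → sumRange (suc i) n h) (ℕ.+-∸-assoc 1 i<d) ⟨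
  sumRange (suc i) (d ℕ.∸ i) h                                ∎
  where
  open ≡-Reasoning
  D : ℚ
  D = ℕ→ℚ (denominator d i)
  k : ℕ
  k = d ℕ.∸ suc i
  h : ℕ → ℚ
  h j = ℕ→ℚ (f i j) * F j d
  clear-denominator : ∀ j → D * (weight d i j * F j d) ≡ h j
  clear-denominator j = trans (sym (*-assoc D (weight d i j) (F j d)))
    (cong (_* F j d) (ratio-cancelˡ (f i j) (denominator d i) (ℕ.m<n⇒0<n∸m (suc-!-mono-< i<d))))

F-recursion : ∀ {i d} → i ℕ.≤ d →
              ℕ→ℚ (denominator d i) * F i d ≡ sumRange (suc i) (d ℕ.∸ i) (λ j → ℕ→ℚ (f i j) * F j d)
F-recursion {i} i≤d = [ F-recursion-< , (λ i≡d → subst Recursion i≡d (F-recursion-diagonal i)) ]′ (ℕ.m≤n⇒m<n∨m≡n i≤d)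
  where
  Recursion : ℕ → Set
  Recursion d = ℕ→ℚ (denominator d i) * F i d ≡ sumRange (suc i) (d ℕ.∸ i) (λ j → ℕ→ℚ (f i j) * F j d)

F-eigenRow : ∀ {i d} → i ℕ.≤ d → sumRange 0 (suc d) (λ j → ℕ→ℚ (f i j) * F j d) ≡ ℕ→ℚ (suc d !) * F i d
F-eigenRow {i} {d} i≤d = begin
  sumRange 0 (suc d) h                                              ≡⟨ cong (λ n → sumRange 0 n h) 1+d≡i+[1+d∸i] ⟩
  sumRange 0 (i ℕ.+ suc (d ℕ.∸ i)) h                                ≡⟨ sumRange-split 0 i (suc (d ℕ.∸ i)) h ⟩
  sumRange 0 i h + (h i + sumRange (suc i) (d ℕ.∸ i) h)             ≡⟨ cong₂ (λ s t → s + (t + sumRange (suc i) (d ℕ.∸ i) h)) below diagonal ⟩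
  0ℚ + (ℕ→ℚ (suc i !) * F i d + sumRange (suc i) (d ℕ.∸ i) h)       ≡⟨ +-identityˡ _ ⟩
  ℕ→ℚ (suc i !) * F i d + sumRange (suc i) (d ℕ.∸ i) h              ≡⟨ cong (λ s → ℕ→ℚ (suc i !) * F i d + s) (F-recursion i≤d) ⟨
  ℕ→ℚ (suc i !) * F i d + ℕ→ℚ (denominator d i) * F i d            ≡⟨ *-distribʳ-+ (F i d) (ℕ→ℚ (suc i !)) (ℕ→ℚ (denominator d i)) ⟨
  (ℕ→ℚ (suc i !) + ℕ→ℚ (denominator d i)) * F i d                   ≡⟨ cong (_* F i d) (ℕ→ℚ-+ (suc i !) (denominator d i)) ⟨
  ℕ→ℚ (suc i ! ℕ.+ denominator d i) * F i d                         ≡⟨ cong (λ n → ℕ→ℚ n * F i d) (ℕ.m+[n∸m]≡n (!-mono-≤ (s≤s i≤d))) ⟩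
  ℕ→ℚ (suc d !) * F i d                                             ∎
  where
  open ≡-Reasoning
  h : ℕ → ℚ
  h j = ℕ→ℚ (f i j) * F j d
  1+d≡i+[1+d∸i] : suc d ≡ i ℕ.+ suc (d ℕ.∸ i)
  1+d≡i+[1+d∸i] = sym (trans (ℕ.+-suc i (d ℕ.∸ i)) (cong suc (ℕ.m+[n∸m]≡n i≤d)))
  below : sumRange 0 i h ≡ 0ℚ
  below = sumRange-zero 0 i h (λ j j<i → trans (cong (λ n → ℕ→ℚ n * F j d) (f-belowDiagonal j<i)) (*-zeroˡ (F j d)))
  diagonal : h i ≡ ℕ→ℚ (suc i !) * F i d
  diagonal = cong (λ n → ℕ→ℚ n * F i d) (f-diagonal i)

fMat-eigenvector : ∀ d i → Σℚ (λ j → ℕ→ℚ (fMat d i j) * Fvec d j) ≡ ℕ→ℚ (suc d !) * Fvec d i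
fMat-eigenvector d zero = begin
  ℕ→ℚ 1 * 0ℚ + Σℚ {suc d} (λ j → 0ℚ * Fvec d (suc j))   ≡⟨ cong₂ _+_ (*-zeroʳ (ℕ→ℚ 1)) (Σℚ-zero _ (λ j → *-zeroˡ (Fvec d (suc j)))) ⟩
  0ℚ + 0ℚ                                        ≡⟨ *-zeroʳ (ℕ→ℚ (suc d !)) ⟨
  ℕ→ℚ (suc d !) * 0ℚ                             ∎
  where open ≡-Reasoning
fMat-eigenvector d (suc i) = begin
  ℕ→ℚ 0 * 0ℚ + Σℚ {suc d} (λ j → ℕ→ℚ (f (toℕ i) (toℕ j)) * Fvec d (suc j))
    ≡⟨ cong₂ _+_ (*-zeroˡ 0ℚ) (Σℚ-cong (λ j → cong (ℕ→ℚ (f (toℕ i) (toℕ j)) *_) (Fvec-suc d j))) ⟩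
  0ℚ + Σℚ {suc d} (λ j → ℕ→ℚ (f (toℕ i) (toℕ j)) * F (toℕ j) d)
    ≡⟨ +-identityˡ _ ⟩
  Σℚ {suc d} (λ j → ℕ→ℚ (f (toℕ i) (toℕ j)) * F (toℕ j) d)
    ≡⟨ Σℚ≡sumRange (suc d) (λ m → ℕ→ℚ (f (toℕ i) m) * F m d) ⟩
  sumRange 0 (suc d) (λ m → ℕ→ℚ (f (toℕ i) m) * F m d)
    ≡⟨ F-eigenRow (ℕ.≤-pred (toℕ<n i)) ⟩
  ℕ→ℚ (suc d !) * F (toℕ i) d
    ≡⟨ cong (ℕ→ℚ (suc d !) *_) (Fvec-suc d i) ⟨
  ℕ→ℚ (suc d !) * Fvec d (suc i) ∎
  where open ≡-Reasoning

Fvec-last : ∀ d → Fvec d (suc (fromℕ d)) ≡ 1ℚ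
Fvec-last d = trans (Fvec-suc d (fromℕ d)) (trans (cong (λ n → F n d) (toℕ-fromℕ d)) (F-diagonal d))

lemma2p4 : (d : ℕ) →
  ((x : ℚ) → charPoly (λ i j → ℕ→ℚ (fMat d i j)) x
               ≡ Πℚ (λ (k : Fin (suc (suc d))) → x - ℕ→ℚ (toℕ k !)))
  × ((∃ λ (k : Fin (suc (suc d))) → Fvec d k ≢ 0ℚ)
     × ((i : Fin (suc (suc d))) →
          Σℚ (λ j → ℕ→ℚ (fMat d i j) * Fvec d j) ≡ ℕ→ℚ (suc d !) * Fvec d i))
lemma2p4 d = charPoly-fMat d
           , (suc (fromℕ d) , λ Fvec-last≡0 → 1≢0 (trans (sym (Fvec-last d)) Fvec-last≡0))
           , fMat-eigenvector d
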